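{- There is a function $g:\mathbb N\to\mathbb N$ with $g(n)=o(n^2)$ such that every graph on $n$ vertices has a separating $\mathcal B$-system of size at most $g(n)$.
   Context: $\mathcal B$ denotes the class of balanced complete bipartite graphs $K_{m,m}$, $m\ge 1$ (so $K_{1,1}=K_2\in\mathcal B$). A separating $\mathcal B$-system of a graph $G$ is a family $\mathcal F$ of subgraphs of $G$, each isomorphic to a member of $\mathcal B$, such that for every two distinct edges $e,e'\in E(G)$ there is $F\in\mathcal F$ containing $e$ but not $e'$ and there is $F'\in\mathcal F$ containing $e'$ but not $e$. -}

module Defs where

open import Data.Nat using (ℕ; _≤_; _*_; _^_; suc)
open import Data.Fin using (Fin; _<_)
open import Data.Fin.Subset using (Subset; _∈_; _∉_; ∣_∣)
open import Data.List using (List)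
open import Data.List.Membership.Propositional using () renaming (_∈_ to _∈ˡ_)
open import Data.Product using (Σ; _×_; ∃; ∃-syntax)
open import Data.Sum using (_⊎_)
open import Relation.Binary.PropositionalEquality using (_≡_; _≢_)
open import Relation.Nullary using (¬_)
open import Relation.Binary.Definitions using (Decidable)

record Graph (n : ℕ) : Set₁ where
  field
    Adj    : Fin n → Fin n → Set
    sym    : ∀ {u v} → Adj u v → Adj v u
    irrefl : ∀ {u} → ¬ Adj u u
    dec    : Decidable Adj
open Graph public

-- A subgraph of G isomorphic to K_{m,m} (m ≥ 1): given by its two sides
-- A and B, disjoint, of equal size m ≥ 1, with every A–B pair an edge of G.
-- Its edge set is exactly the set of A–B pairs.
record Biclique {n : ℕ} (G : Graph n) : Set where
  field
    sideA    : Subset n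
    sideB    : Subset n
    disjoint : ∀ x → x ∈ sideA → x ∉ sideB
    balanced : ∣ sideA ∣ ≡ ∣ sideB ∣
    nonempty : 1 ≤ ∣ sideA ∣
    complete : ∀ a b → a ∈ sideA → b ∈ sideB → Adj G a b
open Biclique public

EdgeIn : ∀ {n} {G : Graph n} → Biclique G → Fin n → Fin n → Set
EdgeIn F u v = (u ∈ sideA F × v ∈ sideB F) ⊎ (v ∈ sideA F × u ∈ sideB F)

-- Separating: for every ordered pair of distinct edges e, e' there is F in
-- the family containing e but not e' (applied to both orders this gives
-- the two-sided condition).
Separating : ∀ {n} (G : Graph n) → List (Biclique G) → Set
Separating {n} G 𝓕 =
  ∀ (u v u' v' : Fin n) → u < v → Adj G u v → u' < v' → Adj G u' v' →
  (u ≢ u' ⊎ v ≢ v') →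
  ∃[ F ] (F ∈ˡ 𝓕 × EdgeIn F u v × ¬ EdgeIn F u' v')

LittleOSquare : (ℕ → ℕ) → Set
LittleOSquare g = ∀ (k : ℕ) → 1 ≤ k → ∃[ N ] (∀ n → N ≤ n → k * g n ≤ n ^ 2)

{-# OPTIONS --safe #-}
-- Order the vertices and cut them into blocks of s = m² consecutive vertices, where m = (h+1)².
-- Inside a block every edge gets its own K₁,₁. The edges from a block X to the set W of later
-- vertices are handled by splitting W into at most 2^s classes by neighbourhood in X: each class V
-- is completely joined to the set T of its common neighbours in X. Cutting T and V into chunks of
-- m vertices, two chunks span a K_{m,m}; reading each side as an (h+1)×(h+1) grid, the 2m
-- bicliques pairing a row with a row or a column with a column separate all m² of its edges,
-- because a row biclique and a column biclique share exactly one edge. The edges at the chunk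
-- leftovers again get their own K₁,₁. A block then costs about 3mn + 2^s·m³ + s² bicliques, so
-- the whole graph needs O(n²/m + n·2^s·m³); letting m grow slowly with n (the best h ≤ n) gives
-- o(n²).
module Submission where

open import Defs hiding (sym)
open import Data.Nat as ℕ using (ℕ; zero; suc; _+_; _*_; _^_; _≤_; z≤n; s≤s; NonZero)
import Data.Nat.Properties as ℕ
open import Data.Nat.DivMod using (_/_; _%_; m/n*n≤m; m/n≤m; m%n<n; m%n≡m∸m/n*n; m≡m%n+[m/n]*n)
open import Data.Nat.Tactic.RingSolver using (solve-∀)
open import Data.Fin as Fin using (Fin; zero; suc; combine; _<_)
import Data.Fin.Properties as Fin
open import Data.Fin.Subset using (Subset; ⊥; ⁅_⁆; _∪_; ∣_∣; inside; outside) renaming (_∈_ to _∈ₛ_; _∉_ to _∉ₛ_)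
open import Data.Fin.Subset.Properties using (x∈p∪q⁺; x∈p∪q⁻; x∈⁅x⁆; x∈⁅y⁆⇒x≡y; ∉⊥; ∣⊥∣≡0; ∪-identityˡ) renaming (_∈?_ to _∈ₛ?_)
open import Data.Vec using (_∷_; here; there)
open import Data.List using (List; []; _∷_; [_]; _++_; length; map; concatMap; cartesianProduct; cartesianProductWith; filter; take; drop; allFin; upTo)
open import Data.List.Properties using (length-++; length-map; length-take; length-drop; length-filter; length-tabulate; take++drop≡id; drop-drop)
open import Data.List.Membership.Propositional using (_∈_; lose)
open import Data.List.Membership.Propositional.Properties using (∈-++⁺ˡ; ∈-++⁺ʳ; ∈-++⁻; ∈-map⁺; ∈-concatMap⁺; ∈-cartesianProduct⁺; ∈-cartesianProductWith⁺; ∈-allFin; ∈-filter⁺; ∈-filter⁻; ∈-upTo⁺)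
open import Data.List.Relation.Binary.Subset.Propositional using (_⊆_)
open import Data.List.Relation.Unary.Any using (here; there)
open import Data.List.Relation.Unary.All as All using (All; _∷_; all?)
import Data.List.Relation.Unary.All.Properties as All
open import Data.List.Relation.Unary.AllPairs as AllPairs using (AllPairs; _∷_)
import Data.List.Relation.Unary.AllPairs.Properties as AllPairs
open import Data.List.Relation.Unary.Unique.Propositional using (Unique)
import Data.List.Relation.Unary.Unique.Propositional.Properties as Unique
open import Data.List.Extrema.Nat using (argmin; f[argmin]≤v⁺)
open import Data.Product using (_×_; _,_; proj₁; proj₂; ∃-syntax; uncurry)
open import Data.Sum using (_⊎_; inj₁; inj₂)
open import Data.Empty using (⊥-elim)
open import Function using (_∘_; Injective)
open import Relation.Binary.PropositionalEquality using (_≡_; _≢_; refl; sym; trans; cong; cong₂; subst; subst₂)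
open import Relation.Nullary using (¬_; Dec; yes; no; _×-dec_; _⊎-dec_)
open import Relation.Unary using (Decidable)
open import Relation.Unary.Properties using (∁?)

private
  variable
    A B C : Set

length-++-≤ : ∀ (xs : List A) {ys a b} → length xs ≤ a → length ys ≤ b → length (xs ++ ys) ≤ a + b
length-++-≤ xs p q = subst (_≤ _) (sym (length-++ xs)) (ℕ.+-mono-≤ p q)

length-concatMap-≤ : ∀ (f : A → List B) xs {b} → (∀ x → length (f x) ≤ b) → length (concatMap f xs) ≤ length xs * b
length-concatMap-≤ f []       bound = z≤n
length-concatMap-≤ f (x ∷ xs) bound = length-++-≤ (f x) (bound x) (length-concatMap-≤ f xs bound)

length-cartesianProductWith : ∀ (f : A → B → C) xs ys → length (cartesianProductWith f xs ys) ≡ length xs * length ys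
length-cartesianProductWith f []       ys = refl
length-cartesianProductWith f (x ∷ xs) ys =
  trans (length-++ (map (f x) ys)) (cong₂ _+_ (length-map (f x) ys) (length-cartesianProductWith f xs ys))

length-allFin : ∀ k → length (allFin k) ≡ k
length-allFin k = length-tabulate (λ i → i)

∈-concatMap⁺′ : ∀ (f : A → List B) {xs x y} → x ∈ xs → y ∈ f x → y ∈ concatMap f xs
∈-concatMap⁺′ f x∈ y∈ = ∈-concatMap⁺ f (lose x∈ y∈)

length-filter-∁ : ∀ {P : A → Set} (P? : Decidable P) xs →
                  length (filter P? xs) + length (filter (∁? P?) xs) ≡ length xs
length-filter-∁ P? []       = refl
length-filter-∁ P? (x ∷ xs) with P? x
... | yes _ = cong suc (length-filter-∁ P? xs)
... | no  _ = trans (ℕ.+-suc _ _) (cong suc (length-filter-∁ P? xs))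

length-take-≤ : ∀ k (xs : List A) → length (take k xs) ≤ k
length-take-≤ k xs = subst (_≤ k) (sym (length-take k xs)) (ℕ.m⊓n≤m k (length xs))

length-drop-≤ : ∀ k (xs : List A) → length (drop k xs) ≤ length xs
length-drop-≤ k xs = subst (_≤ length xs) (sym (length-drop k xs)) (ℕ.m∸n≤m (length xs) k)

∈-take⊎drop : ∀ k {xs : List A} {x} → x ∈ xs → x ∈ take k xs ⊎ x ∈ drop k xs
∈-take⊎drop k {xs} x∈ = ∈-++⁻ (take k xs) (subst (_ ∈_) (sym (take++drop≡id k xs)) x∈)

drop⊆ : ∀ k (xs : List A) → drop k xs ⊆ xs
drop⊆ k xs x∈ = subst (_ ∈_) (take++drop≡id k xs) (∈-++⁺ʳ (take k xs) x∈)

AllPairs-++⇒ : ∀ {R : A → A → Set} {xs ys x y} → AllPairs R (xs ++ ys) → x ∈ xs → y ∈ ys → R x y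
AllPairs-++⇒ {xs = _ ∷ xs} (Rx ∷ _) (here refl) y∈ = All.lookup Rx (∈-++⁺ʳ xs y∈)
AllPairs-++⇒ {xs = _ ∷ _} (_ ∷ R*) (there x∈) y∈ = AllPairs-++⇒ R* x∈ y∈

AllPairs-take-drop : ∀ {R : A → A → Set} k {xs x y} → AllPairs R xs → x ∈ take k xs → y ∈ drop k xs → R x y
AllPairs-take-drop k {xs} R* = AllPairs-++⇒ (subst (AllPairs _) (sym (take++drop≡id k xs)) R*)

AllPairs<⇒Unique : ∀ {n} {xs : List (Fin n)} → AllPairs _<_ xs → Unique xs
AllPairs<⇒Unique = AllPairs.map Fin.<⇒≢

≢-pair : ∀ {a b : A} {c d : B} → a ≢ b ⊎ c ≢ d → (a , c) ≢ (b , d)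
≢-pair (inj₁ a≢b) refl = a≢b refl
≢-pair (inj₂ c≢d) refl = c≢d refl

const-injective : ∀ (x : A) → Injective _≡_ _≡_ (λ (_ : Fin 1) → x)
const-injective x {zero} {zero} _ = refl

module _ {A : Set} where

  prefix : ∀ k (xs : List A) → k ≤ length xs → Fin k → A
  prefix (suc k) (x ∷ xs) (s≤s p) zero    = x
  prefix (suc k) (x ∷ xs) (s≤s p) (suc i) = prefix k xs p i

  prefix-∈ : ∀ k xs p i → prefix k xs p i ∈ xs
  prefix-∈ (suc k) (x ∷ xs) (s≤s p) zero    = here refl
  prefix-∈ (suc k) (x ∷ xs) (s≤s p) (suc i) = there (prefix-∈ k xs p i)

  prefix-injective : ∀ k xs p → Unique xs → Injective _≡_ _≡_ (prefix k xs p)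
  prefix-injective (suc k) (x ∷ xs) (s≤s p) u        {zero}  {zero}  eq = refl
  prefix-injective (suc k) (x ∷ xs) (s≤s p) (x∉ ∷ u) {zero}  {suc j} eq = ⊥-elim (All.lookup x∉ (prefix-∈ k xs p j) eq)
  prefix-injective (suc k) (x ∷ xs) (s≤s p) (x∉ ∷ u) {suc i} {zero}  eq = ⊥-elim (All.lookup x∉ (prefix-∈ k xs p i) (sym eq))
  prefix-injective (suc k) (x ∷ xs) (s≤s p) (_ ∷ u)  {suc i} {suc j} eq = cong suc (prefix-injective k xs p u eq)

  prefix⊎drop : ∀ k xs p {y} → y ∈ xs → (∃[ i ] prefix k xs p i ≡ y) ⊎ y ∈ drop k xs
  prefix⊎drop zero    xs       p       y∈           = inj₂ y∈
  prefix⊎drop (suc k) (x ∷ xs) (s≤s p) (here refl)  = inj₁ (zero , refl)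
  prefix⊎drop (suc k) (x ∷ xs) (s≤s p) (there y∈) with prefix⊎drop k xs p y∈
  ... | inj₁ (i , eq) = inj₁ (suc i , eq)
  ... | inj₂ y∈′      = inj₂ y∈′

  record Chunk (m : ℕ) (xs : List A) : Set where
    field
      entry     : Fin m → A
      injective : Injective _≡_ _≡_ entry
      entry∈    : ∀ i → entry i ∈ xs
  open Chunk public

  Chunk-⊆ : ∀ {m xs ys} → xs ⊆ ys → Chunk m xs → Chunk m ys
  Chunk-⊆ xs⊆ys C = record { entry = entry C ; injective = injective C ; entry∈ = xs⊆ys ∘ entry∈ C }

  module _ (m : ℕ) where

    chunks : ∀ c (xs : List A) → c * m ≤ length xs → Unique xs → List (Chunk m xs)
    chunks zero    xs p u = []
    chunks (suc c) xs p u = first ∷ map (Chunk-⊆ (drop⊆ m xs)) (chunks c (drop m xs) p′ (Unique.drop⁺ m u))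
      where
      m≤ : m ≤ length xs
      m≤ = ℕ.m+n≤o⇒m≤o m p
      first : Chunk m xs
      first = record { entry = prefix m xs m≤ ; injective = prefix-injective m xs m≤ u ; entry∈ = prefix-∈ m xs m≤ }
      p′ : c * m ≤ length (drop m xs)
      p′ = subst₂ _≤_ (ℕ.m+n∸m≡n m (c * m)) (sym (length-drop m xs)) (ℕ.∸-monoˡ-≤ m p)

    length-chunks : ∀ c xs p u → length (chunks c xs p u) ≡ c
    length-chunks zero    xs p u = refl
    length-chunks (suc c) xs p u =
      cong suc (trans (length-map _ (chunks c (drop m xs) _ _)) (length-chunks c (drop m xs) _ _))

    chunks⊎drop : ∀ c xs p u {y} → y ∈ xs →
                  (∃[ C ] C ∈ chunks c xs p u × ∃[ i ] entry C i ≡ y) ⊎ y ∈ drop (c * m) xs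
    chunks⊎drop zero    xs p u y∈ = inj₂ y∈
    chunks⊎drop (suc c) xs p u y∈ with prefix⊎drop m xs _ y∈
    ... | inj₁ i,eq = inj₁ (_ , here refl , i,eq)
    ... | inj₂ y∈drop with chunks⊎drop c (drop m xs) _ (Unique.drop⁺ m u) y∈drop
    ...   | inj₁ (C , C∈ , i,eq) = inj₁ (Chunk-⊆ (drop⊆ m xs) C , there (∈-map⁺ _ C∈) , i,eq)
    ...   | inj₂ y∈rest          = inj₂ (subst (_ ∈_) (drop-drop m (c * m) xs) y∈rest)

    module _ .{{_ : NonZero m}} where

      chunksOf : ∀ xs → Unique xs → List (Chunk m xs)
      chunksOf xs = chunks (length xs / m) xs (m/n*n≤m (length xs) m)

      leftover : List A → List A
      leftover xs = drop (length xs / m * m) xs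

      length-chunksOf : ∀ xs u → length (chunksOf xs u) * m ≤ length xs
      length-chunksOf xs u =
        subst (λ c → c * m ≤ length xs) (sym (length-chunks (length xs / m) xs _ u)) (m/n*n≤m (length xs) m)

      length-leftover : ∀ xs → length (leftover xs) ℕ.< m
      length-leftover xs = subst (ℕ._< m)
        (trans (m%n≡m∸m/n*n (length xs) m) (sym (length-drop (length xs / m * m) xs)))
        (m%n<n (length xs) m)

      chunksOf⊎leftover : ∀ {xs} u {y} → y ∈ xs →
                          (∃[ C ] C ∈ chunksOf xs u × ∃[ i ] entry C i ≡ y) ⊎ y ∈ leftover xs
      chunksOf⊎leftover {xs} u = chunks⊎drop (length xs / m) xs _ u

image : ∀ {k n} → (Fin k → Fin n) → Subset n
image {zero}  f = ⊥
image {suc k} f = ⁅ f zero ⁆ ∪ image (f ∘ suc)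

∈-image⁺ : ∀ {k n} (f : Fin k → Fin n) i → f i ∈ₛ image f
∈-image⁺ f zero    = x∈p∪q⁺ (inj₁ (x∈⁅x⁆ (f zero)))
∈-image⁺ f (suc i) = x∈p∪q⁺ {p = ⁅ f zero ⁆} (inj₂ (∈-image⁺ (f ∘ suc) i))

∈-image⁻ : ∀ {k n} (f : Fin k → Fin n) {x} → x ∈ₛ image f → ∃[ i ] f i ≡ x
∈-image⁻ {zero}  f x∈ = ⊥-elim (∉⊥ x∈)
∈-image⁻ {suc k} f x∈ with x∈p∪q⁻ ⁅ f zero ⁆ (image (f ∘ suc)) x∈
... | inj₁ x∈⁅f0⁆ = zero , sym (x∈⁅y⁆⇒x≡y (f zero) x∈⁅f0⁆)
... | inj₂ x∈rest with ∈-image⁻ (f ∘ suc) x∈rest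
...   | i , eq = suc i , eq

∣⁅x⁆∪p∣≡1+∣p∣ : ∀ {n} (x : Fin n) (p : Subset n) → x ∉ₛ p → ∣ ⁅ x ⁆ ∪ p ∣ ≡ suc ∣ p ∣
∣⁅x⁆∪p∣≡1+∣p∣ zero    (outside ∷ p) x∉ = cong (suc ∘ ∣_∣) (∪-identityˡ p)
∣⁅x⁆∪p∣≡1+∣p∣ zero    (inside ∷ p)  x∉ = ⊥-elim (x∉ here)
∣⁅x⁆∪p∣≡1+∣p∣ (suc x) (inside ∷ p)  x∉ = cong suc (∣⁅x⁆∪p∣≡1+∣p∣ x p (x∉ ∘ there))
∣⁅x⁆∪p∣≡1+∣p∣ (suc x) (outside ∷ p) x∉ = ∣⁅x⁆∪p∣≡1+∣p∣ x p (x∉ ∘ there)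

∣image∣ : ∀ {k n} (f : Fin k → Fin n) → Injective _≡_ _≡_ f → ∣ image f ∣ ≡ k
∣image∣ {zero}  {n} f f-inj = ∣⊥∣≡0 n
∣image∣ {suc k}     f f-inj =
  trans (∣⁅x⁆∪p∣≡1+∣p∣ (f zero) _ f0∉) (cong suc (∣image∣ (f ∘ suc) (Fin.suc-injective ∘ f-inj)))
  where
  f0∉ : f zero ∉ₛ image (f ∘ suc)
  f0∉ f0∈ with ∈-image⁻ (f ∘ suc) f0∈
  ... | i , eq with f-inj eq
  ...   | ()

chunkSize blockSize : ℕ → ℕ
chunkSize h = suc h * suc h
blockSize h = chunkSize h * chunkSize h

blockBound familyBound : ℕ → ℕ → ℕ
blockBound h n = (2 * m + m) * n + (2 ^ s * (m * m * m) + s * s)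
  where
  m = chunkSize h
  s = blockSize h
familyBound h n = suc (n / blockSize h) * blockBound h n

module _ {n : ℕ} (G : Graph n) where

  Edge : Fin n → Fin n → Set
  Edge u v = u < v × Adj G u v

  edge? : ∀ u v → Dec (Edge u v)
  edge? u v = u Fin.<? v ×-dec dec G u v

  Family : Set
  Family = List (Biclique G)

  edgeIn? : ∀ (F : Biclique G) u v → Dec (EdgeIn F u v)
  edgeIn? F u v = (u ∈ₛ? sideA F ×-dec v ∈ₛ? sideB F) ⊎-dec (v ∈ₛ? sideA F ×-dec u ∈ₛ? sideB F)

  Separates : Family → Fin n → Fin n → Set
  Separates 𝓕 u v =
    ∀ {u′ v′} → u′ < v′ → (u , v) ≢ (u′ , v′) → ∃[ F ] (F ∈ 𝓕 × EdgeIn F u v × ¬ EdgeIn F u′ v′)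

  Separates-⊆ : ∀ {𝓕 𝓕′ u v} → 𝓕 ⊆ 𝓕′ → Separates 𝓕 u v → Separates 𝓕′ u v
  Separates-⊆ 𝓕⊆𝓕′ sep u′<v′ ne with sep u′<v′ ne
  ... | F , F∈ , e∈F , e′∉F = F , 𝓕⊆𝓕′ F∈ , e∈F , e′∉F

  separates-by-intersection : ∀ {𝓕 F F′ u v} → F ∈ 𝓕 → F′ ∈ 𝓕 → EdgeIn F u v → EdgeIn F′ u v →
    (∀ {u′ v′} → u′ < v′ → EdgeIn F u′ v′ → EdgeIn F′ u′ v′ → (u , v) ≡ (u′ , v′)) → Separates 𝓕 u v
  separates-by-intersection {F = F} {F′} F∈ F′∈ e∈F e∈F′ meet {u′} {v′} u′<v′ ne
    with edgeIn? F u′ v′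
  ... | no  e′∉F = F , F∈ , e∈F , e′∉F
  ... | yes e′∈F = F′ , F′∈ , e∈F′ , ne ∘ meet u′<v′ e′∈F

  separating : ∀ {𝓕} → (∀ {u v} → Edge u v → Separates 𝓕 u v) → Separating G 𝓕
  separating sep u v u′ v′ u<v uv u′<v′ _ ne = sep (u<v , uv) u′<v′ (≢-pair ne)

  -- Orienting every copy from smaller to larger vertices is what lets EdgeIn-toBiclique⁻ read off
  -- which side each end of an edge u < v lies on.
  record BicliqueCopy (k : ℕ) : Set where
    field
      left right      : Fin k → Fin n
      left-injective  : Injective _≡_ _≡_ left
      right-injective : Injective _≡_ _≡_ right
      isEdge          : ∀ i j → Edge (left i) (right j)

  module _ {k : ℕ} (E : BicliqueCopy (suc k)) where
    open BicliqueCopy E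

    private
      left∉right : ∀ i → left i ∉ₛ image right
      left∉right i left∈ with ∈-image⁻ right left∈
      ... | j , eq = Fin.<-irrefl (sym eq) (proj₁ (isEdge i j))

      sidesDisjoint : ∀ x → x ∈ₛ image left → x ∉ₛ image right
      sidesDisjoint x x∈ with ∈-image⁻ left x∈
      ... | i , refl = left∉right i

      sidesComplete : ∀ a b → a ∈ₛ image left → b ∈ₛ image right → Adj G a b
      sidesComplete a b a∈ b∈ with ∈-image⁻ left a∈ | ∈-image⁻ right b∈
      ... | i , refl | j , refl = proj₂ (isEdge i j)

    toBiclique : Biclique G
    toBiclique = record
      { sideA    = image left
      ; sideB    = image right
      ; disjoint = sidesDisjoint
      ; balanced = trans (∣image∣ left left-injective) (sym (∣image∣ right right-injective))
      ; nonempty = subst (1 ≤_) (sym (∣image∣ left left-injective)) (s≤s z≤n)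
      ; complete = sidesComplete
      }

    EdgeIn-toBiclique⁺ : ∀ i j → EdgeIn toBiclique (left i) (right j)
    EdgeIn-toBiclique⁺ i j = inj₁ (∈-image⁺ left i , ∈-image⁺ right j)

    EdgeIn-toBiclique⁻ : ∀ {u v} → u < v → EdgeIn toBiclique u v →
                         (∃[ i ] left i ≡ u) × (∃[ j ] right j ≡ v)
    EdgeIn-toBiclique⁻ u<v (inj₁ (u∈ , v∈)) = ∈-image⁻ left u∈ , ∈-image⁻ right v∈
    EdgeIn-toBiclique⁻ u<v (inj₂ (v∈ , u∈)) with ∈-image⁻ left v∈ | ∈-image⁻ right u∈
    ... | i , refl | j , refl = ⊥-elim (Fin.<-asym u<v (proj₁ (isEdge i j)))

  restrict : ∀ {j k} → BicliqueCopy k → (σ τ : Fin j → Fin k) →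
             Injective _≡_ _≡_ σ → Injective _≡_ _≡_ τ → BicliqueCopy j
  restrict E σ τ σ-inj τ-inj = record
    { left            = left ∘ σ
    ; right           = right ∘ τ
    ; left-injective  = σ-inj ∘ left-injective
    ; right-injective = τ-inj ∘ right-injective
    ; isEdge          = λ i j → isEdge (σ i) (τ j)
    }
    where open BicliqueCopy E

  edgeCopy : ∀ {u v} → Edge u v → BicliqueCopy 1
  edgeCopy {u} {v} e = record
    { left            = λ _ → u
    ; right           = λ _ → v
    ; left-injective  = const-injective u
    ; right-injective = const-injective v
    ; isEdge          = λ _ _ → e
    }

  edgeBiclique : ∀ {u v} → Edge u v → Biclique G
  edgeBiclique e = toBiclique (edgeCopy e)

  edgeBiclique-separates : ∀ {u v} (e : Edge u v) → Separates [ edgeBiclique e ] u v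
  edgeBiclique-separates e = separates-by-intersection (here refl) (here refl) uv∈ uv∈ meet
    where
    uv∈ = EdgeIn-toBiclique⁺ (edgeCopy e) zero zero
    meet : ∀ {u′ v′} → u′ < v′ → EdgeIn (edgeBiclique e) u′ v′ → EdgeIn (edgeBiclique e) u′ v′ →
           _ ≡ (u′ , v′)
    meet u′<v′ e′∈F _ with EdgeIn-toBiclique⁻ (edgeCopy e) u′<v′ e′∈F
    ... | (_ , refl) , (_ , refl) = refl

  edgeBicliques : Fin n → Fin n → Family
  edgeBicliques u v with edge? u v
  ... | yes e = [ edgeBiclique e ]
  ... | no  _ = []

  length-edgeBicliques : ∀ u v → length (edgeBicliques u v) ≤ 1
  length-edgeBicliques u v with edge? u v
  ... | yes _ = ℕ.≤-refl
  ... | no  _ = z≤n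

  edgeBicliques-separates : ∀ {u v} → Edge u v → Separates (edgeBicliques u v) u v
  edgeBicliques-separates {u} {v} e with edge? u v
  ... | yes e′ = edgeBiclique-separates e′
  ... | no ¬e  = ⊥-elim (¬e e)

  edgeFamily : List (Fin n) → List (Fin n) → Family
  edgeFamily xs ys = concatMap (uncurry edgeBicliques) (cartesianProduct xs ys)

  length-edgeFamily : ∀ xs ys → length (edgeFamily xs ys) ≤ length xs * length ys
  length-edgeFamily xs ys = subst (length (edgeFamily xs ys) ≤_)
    (trans (ℕ.*-identityʳ _) (length-cartesianProductWith _,_ xs ys))
    (length-concatMap-≤ (uncurry edgeBicliques) (cartesianProduct xs ys) (uncurry length-edgeBicliques))

  edgeFamily-separates : ∀ {xs ys x y} → x ∈ xs → y ∈ ys → Edge x y → Separates (edgeFamily xs ys) x y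
  edgeFamily-separates x∈ y∈ e =
    Separates-⊆ (∈-concatMap⁺′ (uncurry edgeBicliques) (∈-cartesianProduct⁺ x∈ y∈)) (edgeBicliques-separates e)

  -- Through combine, each side of E is a (1+h)×(1+w) grid; a row biclique and a column biclique
  -- then share exactly one edge.
  module _ {h w : ℕ} (E : BicliqueCopy (suc h * suc w)) where
    open BicliqueCopy E

    rowCopy : Fin (suc h) → Fin (suc h) → BicliqueCopy (suc w)
    rowCopy a a′ = restrict E (combine a) (combine a′)
      (Fin.combine-injectiveʳ a _ a _) (Fin.combine-injectiveʳ a′ _ a′ _)

    columnCopy : Fin (suc w) → Fin (suc w) → BicliqueCopy (suc h)
    columnCopy b b′ = restrict E (λ a → combine a b) (λ a → combine a b′)
      (Fin.combine-injectiveˡ _ b _ b) (Fin.combine-injectiveˡ _ b′ _ b′)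

    row : Fin (suc h) → Fin (suc h) → Biclique G
    row a a′ = toBiclique (rowCopy a a′)

    column : Fin (suc w) → Fin (suc w) → Biclique G
    column b b′ = toBiclique (columnCopy b b′)

    tile : Family
    tile = cartesianProductWith row (allFin _) (allFin _) ++ cartesianProductWith column (allFin _) (allFin _)

    length-tile : length tile ≡ suc h * suc h + suc w * suc w
    length-tile = trans (length-++ (cartesianProductWith row (allFin _) (allFin _)))
      (cong₂ _+_ (squares (suc h) row) (squares (suc w) column))
      where
      squares : ∀ k (f : Fin k → Fin k → Biclique G) →
                length (cartesianProductWith f (allFin k) (allFin k)) ≡ k * k
      squares k f = trans (length-cartesianProductWith f (allFin k) (allFin k))
                          (cong₂ _*_ (length-allFin k) (length-allFin k))

    tile-separates-grid : ∀ a b a′ b′ → Separates tile (left (combine a b)) (right (combine a′ b′))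
    tile-separates-grid a b a′ b′ = separates-by-intersection
      (∈-++⁺ˡ (∈-cartesianProductWith⁺ row (∈-allFin a) (∈-allFin a′)))
      (∈-++⁺ʳ (cartesianProductWith row (allFin _) (allFin _))
              (∈-cartesianProductWith⁺ column (∈-allFin b) (∈-allFin b′)))
      (EdgeIn-toBiclique⁺ (rowCopy a a′) b b′)
      (EdgeIn-toBiclique⁺ (columnCopy b b′) a a′)
      meet
      where
      meet : ∀ {u′ v′} → u′ < v′ → EdgeIn (row a a′) u′ v′ → EdgeIn (column b b′) u′ v′ →
             (left (combine a b) , right (combine a′ b′)) ≡ (u′ , v′)
      meet u′<v′ inRow inColumn
        with EdgeIn-toBiclique⁻ (rowCopy a a′) u′<v′ inRow | EdgeIn-toBiclique⁻ (columnCopy b b′) u′<v′ inColumn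
      ... | (k , refl) , (l , refl) | (i , eq) , (j , eq′)
        with Fin.combine-injectiveʳ i b a k (left-injective eq) | Fin.combine-injectiveʳ j b′ a′ l (right-injective eq′)
      ...   | refl | refl = refl

    tile-separates : ∀ p p′ → Separates tile (left p) (right p′)
    tile-separates p p′ with Fin.combine-surjective {suc h} {suc w} p | Fin.combine-surjective {suc h} {suc w} p′
    ... | a , b , refl | a′ , b′ , refl = tile-separates-grid a b a′ b′

  module _ (h : ℕ) {T V : List (Fin n)} (T! : Unique T) (V! : Unique V)
           (T→V : ∀ {t v} → t ∈ T → v ∈ V → Edge t v) where

    private
      m : ℕ
      m = chunkSize h

    chunkCopy : Chunk m T → Chunk m V → BicliqueCopy m
    chunkCopy C D = record
      { left            = entry C
      ; right           = entry D
      ; left-injective  = injective C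
      ; right-injective = injective D
      ; isEdge          = λ i j → T→V (entry∈ C i) (entry∈ D j)
      }

    chunkPairs : List (Chunk m T × Chunk m V)
    chunkPairs = cartesianProduct (chunksOf m T T!) (chunksOf m V V!)

    chunkTile : Chunk m T × Chunk m V → Family
    chunkTile (C , D) = tile {h} {h} (chunkCopy C D)

    tiles : Family
    tiles = concatMap chunkTile chunkPairs

    bipartiteFamily : Family
    bipartiteFamily = tiles ++ (edgeFamily (leftover m T) V ++ edgeFamily T (leftover m V))

    bipartiteFamily-separates : ∀ {t v} → t ∈ T → v ∈ V → Separates bipartiteFamily t v
    bipartiteFamily-separates t∈ v∈ with chunksOf⊎leftover m T! t∈ | chunksOf⊎leftover m V! v∈
    ... | inj₁ (C , C∈ , i , refl) | inj₁ (D , D∈ , j , refl) =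
      Separates-⊆ (∈-++⁺ˡ ∘ ∈-concatMap⁺′ chunkTile (∈-cartesianProduct⁺ C∈ D∈))
                  (tile-separates {h} {h} (chunkCopy C D) i j)
    ... | inj₂ t∈leftover | _ =
      Separates-⊆ (∈-++⁺ʳ tiles ∘ ∈-++⁺ˡ) (edgeFamily-separates t∈leftover v∈ (T→V t∈ v∈))
    ... | inj₁ _ | inj₂ v∈leftover =
      Separates-⊆ (∈-++⁺ʳ tiles ∘ ∈-++⁺ʳ _) (edgeFamily-separates t∈ v∈leftover (T→V t∈ v∈))

    length-bipartiteFamily : ∀ q → length T ≤ q * m →
                             length bipartiteFamily ≤ (2 * q + m) * length V + q * m * m
    length-bipartiteFamily q T≤ = begin
      length bipartiteFamily
        ≤⟨ length-++-≤ tiles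
             (length-concatMap-≤ chunkTile chunkPairs (λ (C , D) → ℕ.≤-reflexive (length-tile {h} {h} (chunkCopy C D))))
             (length-++-≤ (edgeFamily (leftover m T) V)
                (length-edgeFamily (leftover m T) V) (length-edgeFamily T (leftover m V))) ⟩
      length chunkPairs * (m + m) + (length (leftover m T) * length V + length T * length (leftover m V))
        ≤⟨ ℕ.+-mono-≤ tilesBound (ℕ.+-mono-≤ (ℕ.*-monoˡ-≤ (length V) (ℕ.<⇒≤ (length-leftover m T)))
                                              (ℕ.*-mono-≤ T≤ (ℕ.<⇒≤ (length-leftover m V)))) ⟩
      q * (length V + length V) + (m * length V + q * m * m)
        ≡⟨ rearrange q m (length V) ⟩
      (2 * q + m) * length V + q * m * m ∎
      where
      open ℕ.≤-Reasoning
      Ts = chunksOf m T T!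
      Vs = chunksOf m V V!
      Ts≤q : length Ts ≤ q
      Ts≤q = ℕ.*-cancelʳ-≤ (length Ts) q m (ℕ.≤-trans (length-chunksOf m T T!) T≤)
      tilesBound : length chunkPairs * (m + m) ≤ q * (length V + length V)
      tilesBound = begin
        length chunkPairs * (m + m)           ≡⟨ cong (_* (m + m)) (length-cartesianProductWith _,_ Ts Vs) ⟩
        length Ts * length Vs * (m + m)       ≡⟨ double (length Ts) (length Vs) m ⟩
        length Ts * (length Vs * m + length Vs * m)
          ≤⟨ ℕ.*-mono-≤ Ts≤q (ℕ.+-mono-≤ (length-chunksOf m V V!) (length-chunksOf m V V!)) ⟩
        q * (length V + length V) ∎
        where
        double : ∀ a b m → a * b * (m + m) ≡ a * (b * m + b * m)
        double = solve-∀
      rearrange : ∀ q m v → q * (v + v) + (m * v + q * m * m) ≡ (2 * q + m) * v + q * m * m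
      rearrange = solve-∀

  module _ (h : ℕ) {X : List (Fin n)} (X! : Unique X) where

    private
      m : ℕ
      m = chunkSize h

    edgesTo? : ∀ W x → Dec (All (Edge x) W)
    edgesTo? W x = all? (edge? x) W

    commonNeighbours : List (Fin n) → List (Fin n)
    commonNeighbours W = filter (edgesTo? W) X

    commonNeighbours→ : ∀ W {t v} → t ∈ commonNeighbours W → v ∈ W → Edge t v
    commonNeighbours→ W t∈ = All.lookup (proj₂ (∈-filter⁻ (edgesTo? W) {xs = X} t∈))

    -- W is split by adjacency to each vertex of X in turn, so each final class has a single
    -- neighbourhood in X and is completely joined to its common neighbours there.
    crossFamily : (xs W : List (Fin n)) → Unique W → Family
    crossFamily [] W W! = bipartiteFamily h (Unique.filter⁺ (edgesTo? W) X!) W! (commonNeighbours→ W)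
    crossFamily (x ∷ xs) W W! =
      crossFamily xs (filter (dec G x) W) (Unique.filter⁺ _ W!) ++
      crossFamily xs (filter (∁? (dec G x)) W) (Unique.filter⁺ _ W!)

    private
      narrow : ∀ {a x xs W} {P : Fin n → Set} (P? : Decidable P) → (a ≡ x → All (Adj G a) (filter P? W)) →
               a ∈ x ∷ xs ⊎ All (Adj G a) W → a ∈ xs ⊎ All (Adj G a) (filter P? W)
      narrow P? a≡x⇒ (inj₁ (here a≡x)) = inj₂ (a≡x⇒ a≡x)
      narrow P? a≡x⇒ (inj₁ (there a∈)) = inj₁ a∈
      narrow P? a≡x⇒ (inj₂ a→W)        = inj₂ (All.filter⁺ P? a→W)

    crossFamily-separates : ∀ xs W W! {a b} → a ∈ X → b ∈ W → Edge a b → All (a <_) W →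
                            a ∈ xs ⊎ All (Adj G a) W → Separates (crossFamily xs W W!) a b
    crossFamily-separates [] W W! a∈ b∈ e a<W (inj₂ a→W) =
      bipartiteFamily-separates h _ W! (commonNeighbours→ W) (∈-filter⁺ (edgesTo? W) a∈ (All.zip (a<W , a→W))) b∈
    crossFamily-separates (x ∷ xs) W W! {a} {b} a∈ b∈ e a<W split with dec G x b
    ... | yes xb = Separates-⊆ ∈-++⁺ˡ (crossFamily-separates xs _ _ a∈ (∈-filter⁺ _ b∈ xb) e (All.filter⁺ _ a<W)
                                        (narrow _ (λ { refl → All.all-filter (dec G a) W }) split))
    ... | no ¬xb = Separates-⊆ (∈-++⁺ʳ _) (crossFamily-separates xs _ _ a∈ (∈-filter⁺ _ b∈ ¬xb) e (All.filter⁺ _ a<W)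
                                             (narrow _ (λ { refl → ⊥-elim (¬xb (proj₂ e)) }) split))

    length-crossFamily : ∀ q → length X ≤ q * m → ∀ xs W W! →
                         length (crossFamily xs W W!) ≤ (2 * q + m) * length W + 2 ^ length xs * (q * m * m)
    length-crossFamily q X≤ [] W W! = begin
      length (crossFamily [] W W!)
        ≤⟨ length-bipartiteFamily h (Unique.filter⁺ (edgesTo? W) X!) W! (commonNeighbours→ W) q
             (ℕ.≤-trans (length-filter (edgesTo? W) X) X≤) ⟩
      (2 * q + m) * length W + q * m * m
        ≡⟨ cong ((2 * q + m) * length W +_) (sym (ℕ.+-identityʳ (q * m * m))) ⟩
      (2 * q + m) * length W + 2 ^ 0 * (q * m * m) ∎
      where open ℕ.≤-Reasoning
    length-crossFamily q X≤ (x ∷ xs) W W! = begin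
      length (crossFamily (x ∷ xs) W W!)
        ≤⟨ length-++-≤ (crossFamily xs W₁ _) (length-crossFamily q X≤ xs W₁ _) (length-crossFamily q X≤ xs W₂ _) ⟩
      c * length W₁ + 2 ^ length xs * K + (c * length W₂ + 2 ^ length xs * K)
        ≡⟨ regroup c (length W₁) (length W₂) (2 ^ length xs) K ⟩
      c * (length W₁ + length W₂) + 2 * 2 ^ length xs * K
        ≡⟨ cong (λ w → c * w + 2 ^ length (x ∷ xs) * K) (length-filter-∁ (dec G x) W) ⟩
      c * length W + 2 ^ length (x ∷ xs) * K ∎
      where
      open ℕ.≤-Reasoning
      c = 2 * q + m
      K = q * m * m
      W₁ = filter (dec G x) W
      W₂ = filter (∁? (dec G x)) W
      regroup : ∀ c a b p K → c * a + p * K + (c * b + p * K) ≡ c * (a + b) + 2 * p * K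
      regroup = solve-∀

  module _ (h : ℕ) where

    private
      m s : ℕ
      m = chunkSize h
      s = blockSize h

    blockFamily : (X W : List (Fin n)) → Unique X → Unique W → Family
    blockFamily X W X! W! = crossFamily h X! X W W! ++ edgeFamily X X

    private
      take! : ∀ {L : List (Fin n)} → AllPairs _<_ L → Unique (take s L)
      take! L↑ = AllPairs<⇒Unique (AllPairs.take⁺ s L↑)

      drop! : ∀ {L : List (Fin n)} → AllPairs _<_ L → Unique (drop s L)
      drop! L↑ = AllPairs<⇒Unique (AllPairs.drop⁺ s L↑)

    blocksFamily : ℕ → (L : List (Fin n)) → AllPairs _<_ L → Family
    blocksFamily zero    L L↑ = []
    blocksFamily (suc c) L L↑ =
      blockFamily (take s L) (drop s L) (take! L↑) (drop! L↑) ++ blocksFamily c (drop s L) (AllPairs.drop⁺ s L↑)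

    blockFamily-separates : ∀ {X W} (X! : Unique X) (W! : Unique W) → (∀ {x w} → x ∈ X → w ∈ W → x < w) →
                            ∀ {u v} → u ∈ X → v ∈ X ⊎ v ∈ W → Edge u v → Separates (blockFamily X W X! W!) u v
    blockFamily-separates {X} {W} X! W! X<W u∈X (inj₁ v∈X) e =
      Separates-⊆ (∈-++⁺ʳ (crossFamily h X! X W W!)) (edgeFamily-separates u∈X v∈X e)
    blockFamily-separates {X} {W} X! W! X<W u∈X (inj₂ v∈W) e =
      Separates-⊆ ∈-++⁺ˡ (crossFamily-separates h X! X W W! u∈X v∈W e (All.tabulate (X<W u∈X)) (inj₁ u∈X))

    blocksFamily-separates : ∀ c L L↑ → length L ≤ c * s → ∀ {u v} → u ∈ L → v ∈ L → Edge u v →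
                             Separates (blocksFamily c L L↑) u v
    blocksFamily-separates zero    (_ ∷ _) _  () _ _ _
    blocksFamily-separates (suc c) L       L↑ L≤ u∈ v∈ e with ∈-take⊎drop s u∈
    ... | inj₁ u∈X = Separates-⊆ ∈-++⁺ˡ (blockFamily-separates _ _ (AllPairs-take-drop s L↑) u∈X (∈-take⊎drop s v∈) e)
    ... | inj₂ u∈W with ∈-take⊎drop s v∈
    ...   | inj₁ v∈X = ⊥-elim (Fin.<-asym (proj₁ e) (AllPairs-take-drop s L↑ v∈X u∈W))
    ...   | inj₂ v∈W = Separates-⊆ (∈-++⁺ʳ _) (blocksFamily-separates c (drop s L) _ rest≤ u∈W v∈W e)
      where
      rest≤ : length (drop s L) ≤ c * s
      rest≤ = subst₂ _≤_ (sym (length-drop s L)) (ℕ.m+n∸m≡n s (c * s)) (ℕ.∸-monoˡ-≤ s L≤)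

    length-blockFamily : ∀ {X W} (X! : Unique X) (W! : Unique W) → length X ≤ s → length W ≤ n →
                         length (blockFamily X W X! W!) ≤ blockBound h n
    length-blockFamily {X} {W} X! W! X≤ W≤ = begin
      length (blockFamily X W X! W!)
        ≤⟨ length-++-≤ (crossFamily h X! X W W!) (length-crossFamily h X! m X≤ X W W!) (length-edgeFamily X X) ⟩
      (2 * m + m) * length W + 2 ^ length X * (m * m * m) + length X * length X
        ≤⟨ ℕ.+-mono-≤ (ℕ.+-mono-≤ (ℕ.*-monoʳ-≤ (2 * m + m) W≤) (ℕ.*-monoˡ-≤ (m * m * m) (ℕ.^-monoʳ-≤ 2 X≤)))
                      (ℕ.*-mono-≤ X≤ X≤) ⟩
      (2 * m + m) * n + 2 ^ s * (m * m * m) + s * s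
        ≡⟨ ℕ.+-assoc ((2 * m + m) * n) _ _ ⟩
      blockBound h n ∎
      where open ℕ.≤-Reasoning

    length-blocksFamily : ∀ c L L↑ → length L ≤ n → length (blocksFamily c L L↑) ≤ c * blockBound h n
    length-blocksFamily zero    L L↑ L≤ = z≤n
    length-blocksFamily (suc c) L L↑ L≤ =
      length-++-≤ (blockFamily (take s L) (drop s L) (take! L↑) (drop! L↑))
        (length-blockFamily (take! L↑) (drop! L↑) (length-take-≤ s L) (ℕ.≤-trans (length-drop-≤ s L) L≤))
        (length-blocksFamily c (drop s L) _ (ℕ.≤-trans (length-drop-≤ s L) L≤))

    allFin↑ : AllPairs _<_ (allFin n)
    allFin↑ = AllPairs.tabulate⁺-< (λ i<j → i<j)

    family : Family
    family = blocksFamily (suc (n / s)) (allFin n) allFin↑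

    family-separating : Separating G family
    family-separating =
      separating (blocksFamily-separates (suc (n / s)) (allFin n) allFin↑ n≤ (∈-allFin _) (∈-allFin _))
      where
      n≤ : length (allFin n) ≤ suc (n / s) * s
      n≤ = begin
        length (allFin n)     ≡⟨ length-allFin n ⟩
        n                     ≡⟨ m≡m%n+[m/n]*n n s ⟩
        n % s + n / s * s     ≤⟨ ℕ.+-monoˡ-≤ (n / s * s) (ℕ.<⇒≤ (m%n<n n s)) ⟩
        suc (n / s) * s       ∎
        where open ℕ.≤-Reasoning

    length-family : length family ≤ familyBound h n
    length-family = length-blocksFamily (suc (n / s)) (allFin n) allFin↑ (ℕ.≤-reflexive (length-allFin n))

k*[1+n/s]*[c*n+E]≤n*n : ∀ k c E s n .{{_ : NonZero s}} → 2 * k * c ≤ s → 2 * k * (c + 2 * E) ℕ.< n →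
                        k * (suc (n / s) * (c * n + E)) ≤ n * n
k*[1+n/s]*[c*n+E]≤n*n k c E s n 2kc≤s large = ℕ.*-cancelˡ-≤ 2 (begin
  2 * (k * (suc a * (c * n + E)))                    ≡⟨ expand k c E a n ⟩
  2 * k * c * (a * n) + 2 * k * (c * n + a * E + E)  ≤⟨ ℕ.+-mono-≤ mainTerm restTerm ⟩
  n * n + n * n                                      ≡⟨ double (n * n) ⟩
  2 * (n * n)                                        ∎)
  where
  open ℕ.≤-Reasoning
  a = n / s
  expand : ∀ k c E a n → 2 * (k * (suc a * (c * n + E))) ≡ 2 * k * c * (a * n) + 2 * k * (c * n + a * E + E)
  expand = solve-∀
  double : ∀ x → x + x ≡ 2 * x
  double = solve-∀
  mainTerm : 2 * k * c * (a * n) ≤ n * n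
  mainTerm = begin
    2 * k * c * (a * n) ≤⟨ ℕ.*-monoˡ-≤ (a * n) 2kc≤s ⟩
    s * (a * n)         ≡⟨ reassociate s a n ⟩
    a * s * n           ≤⟨ ℕ.*-monoˡ-≤ n (m/n*n≤m n s) ⟩
    n * n               ∎
    where
    reassociate : ∀ s a n → s * (a * n) ≡ a * s * n
    reassociate = solve-∀
  E≤nE : E ≤ n * E
  E≤nE = ℕ.m≤n*m E n {{ℕ.>-nonZero (ℕ.≤-trans (s≤s z≤n) large)}}
  restTerm : 2 * k * (c * n + a * E + E) ≤ n * n
  restTerm = begin
    2 * k * (c * n + a * E + E)
      ≤⟨ ℕ.*-monoʳ-≤ (2 * k) (ℕ.+-mono-≤ (ℕ.+-monoʳ-≤ (c * n) (ℕ.*-monoˡ-≤ E (m/n≤m n s))) E≤nE) ⟩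
    2 * k * (c * n + n * E + n * E) ≡⟨ factor k c E n ⟩
    n * (2 * k * (c + 2 * E))       ≤⟨ ℕ.*-monoʳ-≤ n (ℕ.<⇒≤ large) ⟩
    n * n                           ∎
    where
    factor : ∀ k c E n → 2 * k * (c * n + n * E + n * E) ≡ n * (2 * k * (c + 2 * E))
    factor = solve-∀

-- For h = 6k the chunk size m = (6k+1)² is at least 6k, so the dominant term (n/m²)·3m·n is at
-- most n²/(2k).
familyBound-eventually : ∀ k → ∃[ N ] ∀ n → N ≤ n → k * familyBound (6 * k) n ≤ n ^ 2
familyBound-eventually k = suc (2 * k * (c + 2 * E)) , λ n N≤n →
  subst (k * familyBound (6 * k) n ≤_) (cong (n *_) (sym (ℕ.*-identityʳ n)))
        (k*[1+n/s]*[c*n+E]≤n*n k c E s n 2kc≤s N≤n)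
  where
  m = chunkSize (6 * k)
  s = blockSize (6 * k)
  c = 2 * m + m
  E = 2 ^ s * (m * m * m) + s * s
  6k≤m : 6 * k ≤ m
  6k≤m = ℕ.≤-trans (ℕ.n≤1+n (6 * k)) (ℕ.m≤m*n (suc (6 * k)) (suc (6 * k)))
  2kc≤s : 2 * k * c ≤ s
  2kc≤s = begin
    2 * k * c    ≡⟨ triple k m ⟩
    6 * k * m    ≤⟨ ℕ.*-monoˡ-≤ m 6k≤m ⟩
    m * m        ∎
    where
    open ℕ.≤-Reasoning
    triple : ∀ k m → 2 * k * (2 * m + m) ≡ 6 * k * m
    triple = solve-∀

module _ (B : ℕ → ℕ → ℕ) where

  bestIndex : ℕ → ℕ
  bestIndex n = argmin (λ j → B j n) 0 (upTo (suc n))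

  bestIndex-≤ : ∀ {j n} → j ≤ n → B (bestIndex n) n ≤ B j n
  bestIndex-≤ {j} {n} j≤n =
    f[argmin]≤v⁺ {f = λ i → B i n} 0 (upTo (suc n)) (inj₂ (lose (∈-upTo⁺ (s≤s j≤n)) ℕ.≤-refl))

  littleO-bestIndex : (∀ k → ∃[ j ] ∃[ N ] ∀ n → N ≤ n → k * B j n ≤ n ^ 2) →
                      LittleOSquare (λ n → B (bestIndex n) n)
  littleO-bestIndex eventually k _ with eventually k
  ... | j , N , bound = j + N , λ n j+N≤n →
    ℕ.≤-trans (ℕ.*-monoʳ-≤ k (bestIndex-≤ (ℕ.m+n≤o⇒m≤o j j+N≤n))) (bound n (ℕ.m+n≤o⇒n≤o j j+N≤n))

mainTheorem5 : ∃[ g ] (LittleOSquare g ×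
                 (∀ (n : ℕ) (G : Graph n) →
                   ∃[ 𝓕 ] (Separating G 𝓕 × length 𝓕 ≤ g n)))
mainTheorem5 =
  (λ n → familyBound (bestIndex familyBound n) n) ,
  littleO-bestIndex familyBound (λ k → 6 * k , familyBound-eventually k) ,
  λ n G → family G (bestIndex familyBound n) , family-separating G _ , length-family G _
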